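{- Let $F$ be a generic 3D mosaic floor plan whose blocks are labeled $1,\dots,n$, with (vertex- and edge-labeled) corner trees $T_1,\dots,T_8$. Then $T_2, T_4, T_5$ and $T_7$ are determined by $T_1, T_3, T_6$ and $T_8$.
   Context: A 3D mosaic floor plan is a partition of an axis-parallel box $H=[0,a]\times[0,b]\times[0,c]$ (the host box) into axis-parallel boxes (blocks) with pairwise disjoint interiors. A corner is a point that is a vertex of at least one block; it is generic if the combinatorial shape of the local arrangement of blocks around it is stable under every sufficiently small (local) perturbation of the blocks adjacent to it; the floor plan is generic if all its corners are. Corner trees: fix a corner $P$ of $H$. For a block $A$ let $p_A$ be the vertex of $A$ closest to $P$. In a generic floor plan, if $p_A\neq P$ there is exactly one other block $B$ having $p_A$ as a vertex; $B$ is the parent of $A$ with respect to $P$, and it is an $x$-, $y$- or $z$-parent if $A$ and $B$ touch along a face orthogonal to the $x$-, $y$- or $z$-axis respectively, and a $d$-parent if $A\cap B=\{p_A\}$. The corner tree $T_P$ is the rooted tree on the blocks (vertices labeled by the block labels) in which each block other than the one containing $P$ is joined to its parent by an edge labeled $x,y,z$ or $d$ according to the parent type; the root is the block containing $P$. The corners of $H$ are numbered $1=(0,0,c)$, $2=(a,0,c)$, $3=(a,b,c)$, $4=(0,b,c)$, $5=(0,0,0)$, $6=(a,0,0)$, $7=(a,b,0)$, $8=(0,b,0)$, and $T_i$ is the corner tree of corner $i$.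
   Formalization: The host box, the blocks and the perturbed floor plans in the definition of genericity all have rational coordinates. -}

module Defs where

open import Data.Rational using (ℚ; 0ℚ; _-_; ∣_∣; _<_; _≤_)
open import Data.Nat using (ℕ)
open import Data.Fin using (Fin)
open import Data.Product using (Σ; ∃; _×_; _,_)
open import Data.Sum using (_⊎_)
open import Data.Empty using (⊥)
open import Relation.Binary.PropositionalEquality using (_≡_; _≢_)
open import Relation.Nullary using (¬_)
open import Function.Bundles using (_⇔_)

data Axis : Set where
  X Y Z : Axis

Point : Set
Point = Axis → ℚ

_≗ᵖ_ : Point → Point → Set
p ≗ᵖ q = ∀ i → p i ≡ q i

Near : ℚ → Point → Point → Set
Near r p q = ∀ i → ∣ p i - q i ∣ < r

record Box : Set where
  field
    lo hi : Axis → ℚ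
    lo<hi : ∀ i → lo i < hi i
open Box public

_∈B_ : Point → Box → Set
p ∈B A = ∀ i → (lo A i ≤ p i) × (p i ≤ hi A i)

_∈°_ : Point → Box → Set
p ∈° A = ∀ i → (lo A i < p i) × (p i < hi A i)

IsVertex : Point → Box → Set
IsVertex p A = ∀ i → (p i ≡ lo A i) ⊎ (p i ≡ hi A i)

-- A 3D mosaic floor plan with blocks labelled by Fin n, host box
-- H = [0,a]×[0,b]×[0,c] with (a,b,c) = hostHi.
record FloorPlan (n : ℕ) : Set where
  field
    hostHi   : Axis → ℚ
    hostPos  : ∀ i → 0ℚ < hostHi i
    block    : Fin n → Box
    inside   : ∀ A p → p ∈B block A → ∀ i → (0ℚ ≤ p i) × (p i ≤ hostHi i)
    cover    : ∀ p → (∀ i → (0ℚ ≤ p i) × (p i ≤ hostHi i)) → ∃ λ A → p ∈B block A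
    disjoint : ∀ A B p → A ≢ B → p ∈° block A → p ∈° block B → ⊥
open FloorPlan public

Corner : ∀ {n} → FloorPlan n → Point → Set
Corner F p = ∃ λ A → IsVertex p (block F A)

data Sign : Set where
  minus plus : Sign

Octant : Set
Octant = Axis → Sign

-- block A contains all points p + t·s for sufficiently small t > 0
-- (i.e. A fills the octant s of p locally)
OctIn : Box → Point → Octant → Set
OctIn A p s = ∀ i → side i (s i)
  where
  side : Axis → Sign → Set
  side i plus  = (lo A i ≤ p i) × (p i < hi A i)
  side i minus = (lo A i < p i) × (p i ≤ hi A i)

SameLocal : ∀ {n} → FloorPlan n → Point → FloorPlan n → Point → Set
SameLocal F p F' p' = ∀ s A → OctIn (block F A) p s ⇔ OctIn (block F' A) p' s

Close : ∀ {n} → ℚ → FloorPlan n → FloorPlan n → Set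
Close ε F F' =
  (∀ i → hostHi F i ≡ hostHi F' i) ×
  (∀ A i → (∣ lo (block F A) i - lo (block F' A) i ∣ < ε) ×
           (∣ hi (block F A) i - hi (block F' A) i ∣ < ε))

GenericCorner : ∀ {n} → FloorPlan n → Point → Set
GenericCorner F p =
  Σ ℚ λ r → (0ℚ < r) × Σ ℚ λ ε → (0ℚ < ε) ×
   (∀ F' → Close ε F F' →
      Σ Point λ p' → Near r p p' × Corner F' p' × SameLocal F p F' p' ×
        (∀ q → Near r p q → Corner F' q → q ≗ᵖ p'))

Generic : ∀ {n} → FloorPlan n → Set
Generic F = ∀ p → Corner F p → GenericCorner F p

HostCorner : Set
HostCorner = Axis → Sign

cornerPt : ∀ {n} → FloorPlan n → HostCorner → Point
cornerPt F σ i with σ i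
... | minus = 0ℚ
... | plus  = hostHi F i

closestVertex : Box → HostCorner → Point
closestVertex A σ i with σ i
... | minus = lo A i
... | plus  = hi A i

data EdgeLabel : Set where
  x y z d : EdgeLabel

FaceTouch : Axis → Box → Box → Set
FaceTouch i A B =
  ((hi A i ≡ lo B i) ⊎ (hi B i ≡ lo A i)) ×
  (∀ j → j ≢ i → (lo A j < hi B j) × (lo B j < hi A j))

EdgeType : Box → Box → Point → EdgeLabel → Set
EdgeType A B p x = FaceTouch X A B
EdgeType A B p y = FaceTouch Y A B
EdgeType A B p z = FaceTouch Z A B
EdgeType A B p d = ∀ q → ((q ∈B A) × (q ∈B B)) ⇔ (q ≗ᵖ p)

ParentEdge : ∀ {n} → FloorPlan n → HostCorner → Fin n → Fin n → EdgeLabel → Set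
ParentEdge F σ A B ℓ =
  ¬ (closestVertex (block F A) σ ≗ᵖ cornerPt F σ) ×
  (A ≢ B) ×
  IsVertex (closestVertex (block F A) σ) (block F B) ×
  EdgeType (block F A) (block F B) (closestVertex (block F A) σ) ℓ

IsRoot : ∀ {n} → FloorPlan n → HostCorner → Fin n → Set
IsRoot F σ A = cornerPt F σ ∈B block F A

SameTree : ∀ {n} → FloorPlan n → FloorPlan n → HostCorner → Set
SameTree F F' σ =
  (∀ A → IsRoot F σ A ⇔ IsRoot F' σ A) ×
  (∀ A B ℓ → ParentEdge F σ A B ℓ ⇔ ParentEdge F' σ A B ℓ)

-- the eight corners: 1=(0,0,c) 2=(a,0,c) 3=(a,b,c) 4=(0,b,c)
--                    5=(0,0,0) 6=(a,0,0) 7=(a,b,0) 8=(0,b,0)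
mk : Sign → Sign → Sign → HostCorner
mk sx sy sz X = sx
mk sx sy sz Y = sy
mk sx sy sz Z = sz

c1 c2 c3 c4 c5 c6 c7 c8 : HostCorner
c1 = mk minus minus plus
c2 = mk plus  minus plus
c3 = mk plus  plus  plus
c4 = mk minus plus  plus
c5 = mk minus minus minus
c6 = mk plus  minus minus
c7 = mk plus  plus  minus
c8 = mk minus plus  minus

{-# OPTIONS --safe #-}
-- Corners 2, 4, 5 and 7 are each adjacent along x, y and z to three of the corners 1, 3, 6, 8
-- and antipodal to the fourth.  Parent edges reverse between such corners: if B is the
-- i-parent of A for one corner, the two blocks share that vertex and touch along an i-face, and
-- it is also the vertex of B closest to the corner adjacent along i, where A becomes the
-- i-parent of B; a d-parent reverses in the same way between antipodal corners.  So the edges of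
-- T_2 are those of T_1, T_3, T_6 and T_8 read backwards.  The root is then the block without a
-- parent, because every block A whose closest vertex p is not the host corner has a parent:
-- the block filling the octant at p next to A across a free axis is a face parent unless it
-- spills into a second axis; following spills, a two-cycle contradicts disjointness, and a
-- pinwheel of three blocks forces the octant opposite A to be filled by a d-parent.
module Submission where

open import Defs
open import Data.Bool using (Bool; true; false; _∨_; if_then_else_)
open import Data.Empty using (⊥; ⊥-elim)
open import Data.Fin using (Fin)
import Data.Fin.Properties as Fin
open import Data.List using (List; []; _∷_; _++_; map; allFin)
open import Data.List.Membership.Propositional using (_∈_)
open import Data.List.Membership.Propositional.Properties using (∈-allFin; ∈-map⁺; ∈-++⁺ˡ; ∈-++⁺ʳ)
open import Data.List.Relation.Unary.All as All using (All; []; _∷_)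
open import Data.List.Relation.Unary.Any using (here; there)
open import Data.Nat using (ℕ)
open import Data.Product using (Σ; ∃; ∃₂; _×_; _,_; proj₁; proj₂; swap)
open import Data.Rational using (ℚ; 0ℚ; 1ℚ; _<_; _≤_; _+_; _-_; -_; _⊔_; _⊓_)
open import Data.Rational.Properties
  using (_≟_; <-isStrictTotalOrder; <-dense; <-irrefl; ≤-<-trans; <-≤-trans; <⇒≤; <⇒≢; ≤-antisym; ≤-refl; ≤-reflexive; <-cmp; ≤-trans; ≮⇒≥; _≤?_; _<?_; +-monoʳ-<; +-identityʳ; positive⁻¹; negative⁻¹; ⊔-sel; ⊓-sel; p≤p⊔q; p≤q⊔p; p⊓q≤p; p⊓q≤q)
open import Data.Sum using (_⊎_; inj₁; inj₂; [_,_]′) renaming (swap to ⊎-swap)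
open import Function using (id; _∘_)
open import Function.Bundles using (_⇔_; mk⇔; Equivalence)
open import Relation.Binary using (Rel; IsStrictTotalOrder; tri<; tri≈; tri>; Dense; DecidableEquality)
import Relation.Binary.Construct.Flip.EqAndOrd as Flip
open import Relation.Binary.PropositionalEquality hiding ([_])
open import Relation.Nullary using (¬_; Dec; yes; no; does; contradiction; ¬?; _×-dec_)
open import Relation.Nullary.Decidable using (dec-true; dec-false; decidable-stable)

open Equivalence using (to; from)

_≟ₐ_ : DecidableEquality Axis
X ≟ₐ X = yes refl
X ≟ₐ Y = no λ ()
X ≟ₐ Z = no λ ()
Y ≟ₐ X = no λ ()
Y ≟ₐ Y = yes refl
Y ≟ₐ Z = no λ ()
Z ≟ₐ X = no λ ()
Z ≟ₐ Y = no λ ()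
Z ≟ₐ Z = yes refl

axis-search : {P : Axis → Set} → (∀ k → Dec (P k)) → Σ Axis P ⊎ (∀ k → ¬ P k)
axis-search P? with P? X | P? Y | P? Z
... | yes p | _     | _     = inj₁ (X , p)
... | no _  | yes p | _     = inj₁ (Y , p)
... | no _  | no _  | yes p = inj₁ (Z , p)
... | no ¬x | no ¬y | no ¬z = inj₂ λ { X → ¬x ; Y → ¬y ; Z → ¬z }

differs-or-agrees : (p q : Point) → Σ Axis (λ i → p i ≢ q i) ⊎ p ≗ᵖ q
differs-or-agrees p q with axis-search (λ k → ¬? (p k ≟ q k))
... | inj₁ difference = inj₁ difference
... | inj₂ agreement  = inj₂ λ k → decidable-stable (p k ≟ q k) (agreement k)

two-remaining-axes : ∀ i → Σ Axis λ a → Σ Axis λ b → ∀ k → k ≢ i → k ≡ a ⊎ k ≡ b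
two-remaining-axes X = Y , Z , λ { X k≢X → ⊥-elim (k≢X refl) ; Y _ → inj₁ refl ; Z _ → inj₂ refl }
two-remaining-axes Y = X , Z , λ { Y k≢Y → ⊥-elim (k≢Y refl) ; X _ → inj₁ refl ; Z _ → inj₂ refl }
two-remaining-axes Z = X , Y , λ { Z k≢Z → ⊥-elim (k≢Z refl) ; X _ → inj₁ refl ; Y _ → inj₂ refl }

other-axis : ∀ {i j l} → j ≢ i → l ≢ j → i ≢ l → ∀ k → k ≢ i → k ≢ j → k ≡ l
other-axis {i} {j} {l} j≢i l≢j i≢l k k≢i k≢j with two-remaining-axes i
... | _ , _ , remaining with remaining j j≢i | remaining k k≢i | remaining l (≢-sym i≢l)
... | inj₁ refl | inj₁ refl | _         = ⊥-elim (k≢j refl)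
... | inj₂ refl | inj₂ refl | _         = ⊥-elim (k≢j refl)
... | inj₁ refl | inj₂ refl | inj₁ refl = ⊥-elim (l≢j refl)
... | inj₂ refl | inj₁ refl | inj₂ refl = ⊥-elim (l≢j refl)
... | inj₁ refl | inj₂ refl | inj₂ refl = refl
... | inj₂ refl | inj₁ refl | inj₁ refl = refl

axis-trichotomy : ∀ {i j l} → j ≢ i → l ≢ j → i ≢ l → ∀ k → k ≡ i ⊎ k ≡ j ⊎ k ≡ l
axis-trichotomy {i} {j} j≢i l≢j i≢l k with k ≟ₐ i | k ≟ₐ j
... | yes k≡i | _       = inj₁ k≡i
... | no _    | yes k≡j = inj₂ (inj₁ k≡j)
... | no k≢i  | no k≢j  = inj₂ (inj₂ (other-axis j≢i l≢j i≢l k k≢i k≢j))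

opposite : Sign → Sign
opposite minus = plus
opposite plus  = minus

opposite-involutive : ∀ s → opposite (opposite s) ≡ s
opposite-involutive minus = refl
opposite-involutive plus  = refl

flipAt : Axis → HostCorner → HostCorner
flipAt X σ = mk (opposite (σ X)) (σ Y) (σ Z)
flipAt Y σ = mk (σ X) (opposite (σ Y)) (σ Z)
flipAt Z σ = mk (σ X) (σ Y) (opposite (σ Z))

antipode : HostCorner → HostCorner
antipode σ = mk (opposite (σ X)) (opposite (σ Y)) (opposite (σ Z))

Adjacent : Axis → HostCorner → HostCorner → Set
Adjacent i σ τ = τ i ≡ opposite (σ i) × (∀ j → j ≢ i → τ j ≡ σ j)

Antipodal : HostCorner → HostCorner → Set
Antipodal σ τ = ∀ j → τ j ≡ opposite (σ j)

flipAt-adjacent : ∀ i σ → Adjacent i σ (flipAt i σ)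
flipAt-adjacent X σ = refl , λ { X X≢X → ⊥-elim (X≢X refl) ; Y _ → refl ; Z _ → refl }
flipAt-adjacent Y σ = refl , λ { Y Y≢Y → ⊥-elim (Y≢Y refl) ; X _ → refl ; Z _ → refl }
flipAt-adjacent Z σ = refl , λ { Z Z≢Z → ⊥-elim (Z≢Z refl) ; X _ → refl ; Y _ → refl }

adjacent-sym : ∀ {i σ τ} → Adjacent i σ τ → Adjacent i τ σ
adjacent-sym {i} {σ} (τi , τj) =
  trans (sym (opposite-involutive (σ i))) (cong opposite (sym τi)) , λ j j≢i → sym (τj j j≢i)

antipode-antipodal : ∀ σ → Antipodal σ (antipode σ)
antipode-antipodal σ = λ { X → refl ; Y → refl ; Z → refl }

antipodal-sym : ∀ {σ τ} → Antipodal σ τ → Antipodal τ σ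
antipodal-sym {σ} τ≡ j = trans (sym (opposite-involutive (σ j))) (cong opposite (sym (τ≡ j)))

end : Sign → Box → Axis → ℚ
end minus A = lo A
end plus  A = hi A

end-isVertexCoordinate : ∀ s A k → end s A k ≡ lo A k ⊎ end s A k ≡ hi A k
end-isVertexCoordinate minus A k = inj₁ refl
end-isVertexCoordinate plus  A k = inj₂ refl

closestVertex≡end : ∀ A σ k → closestVertex A σ k ≡ end (σ k) A k
closestVertex≡end A σ k with σ k
... | minus = refl
... | plus  = refl

closestVertex-isVertex : ∀ A σ → IsVertex (closestVertex A σ) A
closestVertex-isVertex A σ k
  rewrite closestVertex≡end A σ k = end-isVertexCoordinate (σ k) A k

isVertex⇒∈B : ∀ {p} A → IsVertex p A → p ∈B A
isVertex⇒∈B A vertex k with vertex k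
... | inj₁ p≡lo rewrite p≡lo = ≤-refl , <⇒≤ (lo<hi A k)
... | inj₂ p≡hi rewrite p≡hi = <⇒≤ (lo<hi A k) , ≤-refl

∈B-resp-≗ᵖ : ∀ {p q} A → p ≗ᵖ q → q ∈B A → p ∈B A
∈B-resp-≗ᵖ A p≗q q∈A k rewrite p≗q k = q∈A k

common-point-below : ∀ {a b c} → a < c → b < c → ∃ λ v → a ≤ v × b ≤ v × v < c
common-point-below {a} {b} {c} a<c b<c =
  a ⊔ b , p≤p⊔q a b , p≤q⊔p a b , ⊔<c (⊔-sel a b)
  where
  ⊔<c : a ⊔ b ≡ a ⊎ a ⊔ b ≡ b → a ⊔ b < c
  ⊔<c (inj₁ ⊔≡a) = subst (_< c) (sym ⊔≡a) a<c
  ⊔<c (inj₂ ⊔≡b) = subst (_< c) (sym ⊔≡b) b<c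

common-point-above : ∀ {a b c} → a < b → a < c → ∃ λ v → v ≤ b × v ≤ c × a < v
common-point-above {a} {b} {c} a<b a<c =
  b ⊓ c , p⊓q≤p b c , p⊓q≤q b c , a<⊓ (⊓-sel b c)
  where
  a<⊓ : b ⊓ c ≡ b ⊎ b ⊓ c ≡ c → a < b ⊓ c
  a<⊓ (inj₁ ⊓≡b) = subst (a <_) (sym ⊓≡b) a<b
  a<⊓ (inj₂ ⊓≡c) = subst (a <_) (sym ⊓≡c) a<c

touching-ends : ∀ s {A B : Box} {i} → end s A i ≡ lo B i ⊎ end s A i ≡ hi B i →
                hi A i ≡ lo B i ⊎ hi B i ≡ lo A i → end (opposite s) B i ≡ end s A i
touching-ends plus (inj₁ hiA≡loB) _ = sym hiA≡loB
touching-ends plus _ (inj₁ hiA≡loB) = sym hiA≡loB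
touching-ends plus {A} {i = i} (inj₂ hiA≡hiB) (inj₂ hiB≡loA) =
  ⊥-elim (<⇒≢ (lo<hi A i) (sym (trans hiA≡hiB hiB≡loA)))
touching-ends minus (inj₂ loA≡hiB) _ = sym loA≡hiB
touching-ends minus _ (inj₂ hiB≡loA) = hiB≡loA
touching-ends minus {A} {i = i} (inj₁ loA≡loB) (inj₁ hiA≡loB) =
  ⊥-elim (<⇒≢ (lo<hi A i) (trans loA≡loB (sym hiA≡loB)))

overlapping-ends : ∀ s {A B : Box} {j} → end s A j ≡ lo B j ⊎ end s A j ≡ hi B j →
                   lo A j < hi B j × lo B j < hi A j → end s B j ≡ end s A j
overlapping-ends plus  (inj₂ hiA≡hiB) _             = sym hiA≡hiB
overlapping-ends plus  (inj₁ hiA≡loB) (_ , loB<hiA) = ⊥-elim (<⇒≢ loB<hiA (sym hiA≡loB))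
overlapping-ends minus (inj₁ loA≡loB) _             = sym loA≡loB
overlapping-ends minus (inj₂ loA≡hiB) (loA<hiB , _) = ⊥-elim (<⇒≢ loA<hiB loA≡hiB)

single-point-ends : ∀ s {A B : Box} {j} → end s A j ≡ lo B j ⊎ end s A j ≡ hi B j →
                    (∀ v → lo A j ≤ v → v ≤ hi A j → lo B j ≤ v → v ≤ hi B j → v ≡ end s A j) →
                    end (opposite s) B j ≡ end s A j
single-point-ends plus (inj₁ hiA≡loB) _ = sym hiA≡loB
single-point-ends plus {A} {B} {j} (inj₂ hiA≡hiB) only
  with common-point-below (lo<hi A j) (subst (lo B j <_) (sym hiA≡hiB) (lo<hi B j))
... | v , loA≤v , loB≤v , v<hiA =
  contradiction (only v loA≤v (<⇒≤ v<hiA) loB≤v (subst (v ≤_) hiA≡hiB (<⇒≤ v<hiA))) (<⇒≢ v<hiA)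
single-point-ends minus (inj₂ loA≡hiB) _ = sym loA≡hiB
single-point-ends minus {A} {B} {j} (inj₁ loA≡loB) only
  with common-point-above (lo<hi A j) (subst (_< hi B j) (sym loA≡loB) (lo<hi B j))
... | v , v≤hiA , v≤hiB , loA<v =
  contradiction (only v (<⇒≤ loA<v) v≤hiA (subst (_≤ v) loA≡loB (<⇒≤ loA<v)) v≤hiB) (≢-sym (<⇒≢ loA<v))

opposite-ends⇒touch : ∀ s {A B : Box} {i} → end s A i ≡ end (opposite s) B i →
                      hi A i ≡ lo B i ⊎ hi B i ≡ lo A i
opposite-ends⇒touch plus  e = inj₁ e
opposite-ends⇒touch minus e = inj₂ (sym e)

opposite-ends⇒squeeze : ∀ s {A B : Box} {k q} → end s A k ≡ end (opposite s) B k →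
                        q ∈B A → q ∈B B → q k ≡ end s A k
opposite-ends⇒squeeze plus  {k = k} e q∈A q∈B =
  ≤-antisym (proj₂ (q∈A k)) (subst (_≤ _) (sym e) (proj₁ (q∈B k)))
opposite-ends⇒squeeze minus {k = k} e q∈A q∈B =
  ≤-antisym (subst (_ ≤_) (sym e) (proj₂ (q∈B k))) (proj₁ (q∈A k))

_[_≔_] : Point → Axis → ℚ → Point
(p [ j ≔ v ]) k = if does (k ≟ₐ j) then v else p k

[≔]-updated : ∀ p j v → (p [ j ≔ v ]) j ≡ v
[≔]-updated p j v rewrite dec-true (j ≟ₐ j) refl = refl

[≔]-∈B : ∀ {p} A j {v} → p ∈B A → lo A j ≤ v → v ≤ hi A j → (p [ j ≔ v ]) ∈B A
[≔]-∈B A j p∈A lo≤v v≤hi k with k ≟ₐ j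
... | yes refl = lo≤v , v≤hi
... | no _     = p∈A k

diagonal-section : ∀ {A B : Box} {p} → EdgeType A B p d → p ∈B A → p ∈B B →
                   ∀ j v → lo A j ≤ v → v ≤ hi A j → lo B j ≤ v → v ≤ hi B j → v ≡ p j
diagonal-section {A} {B} {p} meet p∈A p∈B j v loA≤v v≤hiA loB≤v v≤hiB =
  trans (sym ([≔]-updated p j v))
        (to (meet (p [ j ≔ v ])) ([≔]-∈B A j p∈A loA≤v v≤hiA , [≔]-∈B B j p∈B loB≤v v≤hiB) j)

axisLabel : Axis → EdgeLabel
axisLabel X = x
axisLabel Y = y
axisLabel Z = z

faceTouch-sym : ∀ i {A B} → FaceTouch i A B → FaceTouch i B A
faceTouch-sym i (touch , overlapping) = ⊎-swap touch , λ j j≢i → swap (overlapping j j≢i)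

faceTouch⇒axisEdge : ∀ i {A B p} → FaceTouch i A B → EdgeType A B p (axisLabel i)
faceTouch⇒axisEdge X t = t
faceTouch⇒axisEdge Y t = t
faceTouch⇒axisEdge Z t = t

axisEdge⇒faceTouch : ∀ i {A B p} → EdgeType A B p (axisLabel i) → FaceTouch i A B
axisEdge⇒faceTouch X t = t
axisEdge⇒faceTouch Y t = t
axisEdge⇒faceTouch Z t = t

hostFace : ∀ {n} → FloorPlan n → Sign → Axis → ℚ
hostFace F minus k = 0ℚ
hostFace F plus  k = hostHi F k

cornerPt≡hostFace : ∀ {n} (F : FloorPlan n) σ k → cornerPt F σ k ≡ hostFace F (σ k) k
cornerPt≡hostFace F σ k with σ k
... | minus = refl
... | plus  = refl

module _ {n : ℕ} (F : FloorPlan n) where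

  block-within-host : ∀ A k → 0ℚ ≤ lo (block F A) k × hi (block F A) k ≤ hostHi F k
  block-within-host A k =
    proj₁ (inside F A (lo (block F A)) (isVertex⇒∈B (block F A) (λ _ → inj₁ refl)) k) ,
    proj₂ (inside F A (hi (block F A)) (isVertex⇒∈B (block F A) (λ _ → inj₂ refl)) k)

  end≢opposite-hostFace : ∀ s A k → end s (block F A) k ≢ hostFace F (opposite s) k
  end≢opposite-hostFace plus A k =
    ≢-sym (<⇒≢ (≤-<-trans (proj₁ (block-within-host A k)) (lo<hi (block F A) k)))
  end≢opposite-hostFace minus A k =
    <⇒≢ (<-≤-trans (lo<hi (block F A) k) (proj₂ (block-within-host A k)))

  private
    vertex-ends : ∀ σ A B → IsVertex (closestVertex (block F A) σ) (block F B) →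
                  ∀ k → end (σ k) (block F A) k ≡ lo (block F B) k ⊎ end (σ k) (block F A) k ≡ hi (block F B) k
    vertex-ends σ A B vertex k rewrite sym (closestVertex≡end (block F A) σ k) = vertex k

    agreeing-corner : ∀ σ τ A B k → end (τ k) (block F B) k ≡ end (σ k) (block F A) k →
                      closestVertex (block F B) τ k ≡ closestVertex (block F A) σ k
    agreeing-corner σ τ A B k ends≡ =
      trans (closestVertex≡end (block F B) τ k) (trans ends≡ (sym (closestVertex≡end (block F A) σ k)))

  reverse-parent : ∀ {σ τ A B ℓ ℓ′} i → τ i ≡ opposite (σ i) →
                   closestVertex (block F B) τ ≗ᵖ closestVertex (block F A) σ →
                   ParentEdge F σ A B ℓ → EdgeType (block F B) (block F A) (closestVertex (block F B) τ) ℓ′ →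
                   ParentEdge F τ B A ℓ′
  reverse-parent {σ} {τ} {A} {B} i τi shared (_ , A≢B , _ , _) edge =
    off-corner , ≢-sym A≢B , vertex , edge
    where
    open ≡-Reasoning
    vertex : IsVertex (closestVertex (block F B) τ) (block F A)
    vertex k = subst (λ v → v ≡ lo (block F A) k ⊎ v ≡ hi (block F A) k) (sym (shared k))
                     (closestVertex-isVertex (block F A) σ k)
    off-corner : ¬ (closestVertex (block F B) τ ≗ᵖ cornerPt F τ)
    off-corner at-corner = end≢opposite-hostFace (σ i) A i (begin
      end (σ i) (block F A) i         ≡⟨ closestVertex≡end (block F A) σ i ⟨
      closestVertex (block F A) σ i   ≡⟨ shared i ⟨
      closestVertex (block F B) τ i   ≡⟨ at-corner i ⟩
      cornerPt F τ i                  ≡⟨ cornerPt≡hostFace F τ i ⟩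
      hostFace F (τ i) i              ≡⟨ cong (λ s → hostFace F s i) τi ⟩
      hostFace F (opposite (σ i)) i   ∎)

  reverse-face-edge : ∀ {σ τ A B} i → Adjacent i σ τ →
                      ParentEdge F σ A B (axisLabel i) → ParentEdge F τ B A (axisLabel i)
  reverse-face-edge {σ} {τ} {A} {B} i (τi , τj) parent@(_ , _ , vertex , edge) =
    reverse-parent {σ} {τ} {A} {B} i τi shared parent (faceTouch⇒axisEdge i {p = closestVertex (block F B) τ} (faceTouch-sym i {block F A} {block F B} touch))
    where
    touch : FaceTouch i (block F A) (block F B)
    touch = axisEdge⇒faceTouch i edge
    shared : closestVertex (block F B) τ ≗ᵖ closestVertex (block F A) σ
    shared k with k ≟ₐ i
    ... | yes refl = agreeing-corner σ τ A B k (trans (cong (λ s → end s (block F B) k) τi)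
                                            (touching-ends (σ k) (vertex-ends σ A B vertex k) (proj₁ touch)))
    ... | no k≢i   = agreeing-corner σ τ A B k (trans (cong (λ s → end s (block F B) k) (τj k k≢i))
                                            (overlapping-ends (σ k) (vertex-ends σ A B vertex k) (proj₂ touch k k≢i)))

  reverse-diagonal-edge : ∀ {σ τ A B} → Antipodal σ τ → ParentEdge F σ A B d → ParentEdge F τ B A d
  reverse-diagonal-edge {σ} {τ} {A} {B} τ≡ parent@(_ , _ , vertex , meet) =
    reverse-parent {σ} {τ} {A} {B} X (τ≡ X) shared parent meet′
    where
    cA∈A : closestVertex (block F A) σ ∈B block F A
    cA∈A = isVertex⇒∈B (block F A) (closestVertex-isVertex (block F A) σ)
    shared : closestVertex (block F B) τ ≗ᵖ closestVertex (block F A) σ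
    shared k = agreeing-corner σ τ A B k (trans (cong (λ s → end s (block F B) k) (τ≡ k))
      (single-point-ends (σ k) (vertex-ends σ A B vertex k) λ v loA≤v v≤hiA loB≤v v≤hiB →
        trans (diagonal-section {block F A} {block F B} {closestVertex (block F A) σ} meet cA∈A (isVertex⇒∈B (block F B) vertex) k v loA≤v v≤hiA loB≤v v≤hiB)
              (closestVertex≡end (block F A) σ k)))
    meet′ : EdgeType (block F B) (block F A) (closestVertex (block F B) τ) d
    meet′ q = mk⇔ (λ (q∈B , q∈A) k → trans (to (meet q) (q∈A , q∈B) k) (sym (shared k)))
                  (λ q≗ → swap (from (meet q) (λ k → trans (q≗ k) (shared k))))

-- An octant at a vertex p is coded by the axes along which it points towards the host corner
-- (true).  In k B / Out k B: block B occupies the side of p along k away from / towards the corner.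
module _ {Blk : Set} (In Out : Axis → Blk → Set) where

  Side : Bool → Axis → Blk → Set
  Side false = In
  Side true  = Out

  Fills : (Axis → Bool) → Blk → Set
  Fills c B = ∀ k → Side (c k) k B

module Neighbours {Blk : Set} {In Out : Axis → Blk → Set} {Free : Axis → Set}
  (Out? : ∀ k B → Dec (Out k B)) (Out⇒Free : ∀ {k B} → Out k B → Free k)
  {A : Blk} (A-in : ∀ k → In k A) (A-out : ∀ k → ¬ Out k A)
  (fills-unique : ∀ {c B B′} → Fills In Out c B → Fills In Out c B′ → B ≡ B′)
  (fills-exists : ∀ c → (∀ k → c k ≡ true → Free k) → ∃ (Fills In Out c))
  where

  FaceNeighbour : Axis → Blk → Set
  FaceNeighbour i B = Out i B × ¬ In i B × (∀ k → k ≢ i → In k B × ¬ Out k B)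

  DiagonalNeighbour : Blk → Set
  DiagonalNeighbour B = ∀ k → Out k B × ¬ In k B

  Neighbour : Set
  Neighbour = (∃₂ λ i B → FaceNeighbour i B) ⊎ ∃ DiagonalNeighbour

  private
    towards : Axis → Axis → Bool
    towards i k = does (k ≟ₐ i)

    towards₂ : Axis → Axis → Axis → Bool
    towards₂ i j k = does (k ≟ₐ i) ∨ does (k ≟ₐ j)

    towards-out : ∀ {i B} → Fills In Out (towards i) B → Out i B
    towards-out {i} {B} fills = subst (λ b → Side In Out b i B) (dec-true (i ≟ₐ i) refl) (fills i)

    towards-in : ∀ {i k B} → Fills In Out (towards i) B → k ≢ i → In k B
    towards-in {i} {k} {B} fills k≢i = subst (λ b → Side In Out b k B) (dec-false (k ≟ₐ i) k≢i) (fills k)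

    towards-free : ∀ {i} → Free i → ∀ k → towards i k ≡ true → Free k
    towards-free {i} free-i k with k ≟ₐ i
    ... | yes refl = λ _ → free-i
    ... | no _     = λ ()

    fills-towards₂ : ∀ {i j B} → Out i B → Out j B → (∀ k → k ≢ i → k ≢ j → In k B) →
                     Fills In Out (towards₂ i j) B
    fills-towards₂ {i} {j} out-i out-j in-elsewhere k with k ≟ₐ i | k ≟ₐ j
    ... | yes refl | _        = out-i
    ... | no _     | yes refl = out-j
    ... | no k≢i   | no k≢j   = in-elsewhere k k≢i k≢j

    towards-occupant-not-in : ∀ {i B} → Fills In Out (towards i) B → ¬ In i B
    towards-occupant-not-in {i} {B} fills in-i =
      A-out i (subst (Out i) (fills-unique home A-in) (towards-out fills))
      where
      home : Fills In Out (λ _ → false) B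
      home k with k ≟ₐ i
      ... | yes refl = in-i
      ... | no k≢i   = towards-in fills k≢i

    Spill : Axis → Axis → Blk → Set
    Spill i j B = Fills In Out (towards i) B × j ≢ i × Out j B

    step : ∀ i → Free i → Neighbour ⊎ ∃₂ (Spill i)
    step i free-i with fills-exists (towards i) (towards-free free-i)
    ... | B , fills with axis-search (λ j → ¬? (j ≟ₐ i) ×-dec Out? j B)
    ... | inj₁ (j , j≢i , out-j) = inj₂ (j , B , fills , j≢i , out-j)
    ... | inj₂ none = inj₁ (inj₁ (i , B , towards-out fills , towards-occupant-not-in fills ,
                                  λ k k≢i → towards-in fills k≢i , λ out-k → none k (k≢i , out-k)))

    no-two-cycle : ∀ {i j B C} → Spill i j B → Spill j i C → ⊥
    no-two-cycle {i} {j} {B} {C} (fills-B , j≢i , out-j) (fills-C , _ , out-i) =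
      towards-occupant-not-in fills-C (subst (In j) (fills-unique both-B both-C) (towards-in fills-B j≢i))
      where
      both-B : Fills In Out (towards₂ i j) B
      both-B = fills-towards₂ (towards-out fills-B) out-j (λ k k≢i _ → towards-in fills-B k≢i)
      both-C : Fills In Out (towards₂ i j) C
      both-C = fills-towards₂ out-i (towards-out fills-C) (λ k _ k≢j → towards-in fills-C k≢j)

    -- If E reached back along l it would fill B's octant, so B = E would also fill D's octant.
    no-inside-corner : ∀ {i j l B D E} → Spill i j B → Spill l i D → (∀ k → k ≢ i → k ≢ j → k ≡ l) →
                       Fills In Out (λ _ → true) E → ¬ In l E
    no-inside-corner {i} {j} {l} {B} {D} {E} (fills-B , j≢i , out-j) (fills-D , i≢l , out-i) rest all-E in-l =
      towards-occupant-not-in fills-D (subst (In l) (fills-unique il-B il-D) (towards-in fills-B (≢-sym i≢l)))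
      where
      B≡E : B ≡ E
      B≡E = fills-unique (fills-towards₂ (towards-out fills-B) out-j (λ k k≢i _ → towards-in fills-B k≢i))
                         (fills-towards₂ (all-E i) (all-E j)
                           (λ k k≢i k≢j → subst (λ a → In a E) (sym (rest k k≢i k≢j)) in-l))
      il-B : Fills In Out (towards₂ i l) B
      il-B = fills-towards₂ (towards-out fills-B) (subst (Out l) (sym B≡E) (all-E l))
                            (λ k k≢i _ → towards-in fills-B k≢i)
      il-D : Fills In Out (towards₂ i l) D
      il-D = fills-towards₂ out-i (towards-out fills-D) (λ k _ k≢l → towards-in fills-D k≢l)

    pinwheel : ∀ {i j l B C D} → Spill i j B → Spill j l C → Spill l i D → ∃ DiagonalNeighbour
    pinwheel {i} {j} {l} sB@(fills-B , j≢i , _) sC@(fills-C , l≢j , _) sD@(fills-D , i≢l , _)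
      with fills-exists (λ _ → true) (λ k _ → free (axis-trichotomy j≢i l≢j i≢l k))
      where
      free : ∀ {k} → k ≡ i ⊎ k ≡ j ⊎ k ≡ l → Free k
      free (inj₁ refl)        = Out⇒Free (towards-out fills-B)
      free (inj₂ (inj₁ refl)) = Out⇒Free (towards-out fills-C)
      free (inj₂ (inj₂ refl)) = Out⇒Free (towards-out fills-D)
    ... | E , all-E = E , λ k → all-E k , not-in (axis-trichotomy j≢i l≢j i≢l k)
      where
      not-in : ∀ {k} → k ≡ i ⊎ k ≡ j ⊎ k ≡ l → ¬ In k E
      not-in (inj₁ refl)        = no-inside-corner sC sB (other-axis l≢j i≢l j≢i) all-E
      not-in (inj₂ (inj₁ refl)) = no-inside-corner sD sC (other-axis i≢l j≢i l≢j) all-E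
      not-in (inj₂ (inj₂ refl)) = no-inside-corner sB sD (other-axis j≢i l≢j i≢l) all-E

  neighbour-exists : ∀ i → Free i → Neighbour
  neighbour-exists i free-i with step i free-i
  ... | inj₁ found = found
  ... | inj₂ (j , B , sB) with step j (Out⇒Free (proj₂ (proj₂ sB)))
  ...   | inj₁ found = found
  ...   | inj₂ (l , C , sC) with l ≟ₐ i
  ...     | yes refl = ⊥-elim (no-two-cycle sB sC)
  ...     | no l≢i with step l (Out⇒Free (proj₂ (proj₂ sC)))
  ...       | inj₁ found = found
  ...       | inj₂ (m , D , sD) with m ≟ₐ j
  ...         | yes refl = ⊥-elim (no-two-cycle sC sD)
  ...         | no m≢j   = inj₂ (pinwheel sB sC (subst (λ a → Spill l a D) m≡i sD))
    where
    m≡i : m ≡ i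
    m≡i = other-axis (≢-sym (proj₁ (proj₂ sC))) (≢-sym (proj₁ (proj₂ sB))) l≢i m (proj₁ (proj₂ sD)) m≢j

module _ {a ℓ} {A : Set a} {_<_ : Rel A ℓ} (sto : IsStrictTotalOrder _≡_ _<_) (dense : Dense _<_) where

  private
    open IsStrictTotalOrder sto using (compare) renaming (trans to <-trans′)

    lower : ∀ {p w m u} → m < w → ¬ p < u ⊎ w < u → ¬ p < u ⊎ m < u
    lower m<w (inj₁ p≮u) = inj₁ p≮u
    lower m<w (inj₂ w<u) = inj₂ (<-trans′ m<w w<u)

  gap-above : ∀ {p w} → p < w → (vs : List A) → ∃ λ w′ → p < w′ × All (λ v → ¬ p < v ⊎ w′ < v) vs
  gap-above p<w [] = _ , p<w , []
  gap-above {p} p<w (v ∷ vs) with gap-above p<w vs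
  ... | w , p<w′ , clear with compare p v
  ...   | tri≈ p≮v _ _ = w , p<w′ , inj₁ p≮v ∷ clear
  ...   | tri> p≮v _ _ = w , p<w′ , inj₁ p≮v ∷ clear
  ...   | tri< p<v _ _ with compare w v | dense p<v
  ...     | tri< w<v _ _  | _             = w , p<w′ , inj₂ w<v ∷ clear
  ...     | tri≈ _ refl _ | m , p<m , m<v = m , p<m , inj₂ m<v ∷ All.map (lower m<v) clear
  ...     | tri> _ _ v<w  | m , p<m , m<v = m , p<m , inj₂ m<v ∷ All.map (lower (<-trans′ m<v v<w)) clear

p<p+1 : ∀ p → p < p + 1ℚ
p<p+1 p = subst (_< p + 1ℚ) (+-identityʳ p) (+-monoʳ-< p (positive⁻¹ 1ℚ))

p-1<p : ∀ p → p - 1ℚ < p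
p-1<p p = subst (p - 1ℚ <_) (+-identityʳ p) (+-monoʳ-< p (negative⁻¹ (- 1ℚ)))

≤∧≢⇒< : ∀ {a b} → a ≤ b → a ≢ b → a < b
≤∧≢⇒< {a} {b} a≤b a≢b with <-cmp a b
... | tri< a<b _ _ = a<b
... | tri≈ _ a≡b _ = contradiction a≡b a≢b
... | tri> _ _ b<a = contradiction (≤-<-trans a≤b b<a) (<-irrefl refl)

Reaches : Box → Point → Axis → Sign → Set
Reaches A p k plus  = lo A k ≤ p k × p k < hi A k
Reaches A p k minus = lo A k < p k × p k ≤ hi A k

reaches? : ∀ A p k s → Dec (Reaches A p k s)
reaches? A p k plus  = (lo A k ≤? p k) ×-dec (p k <? hi A k)
reaches? A p k minus = (lo A k <? p k) ×-dec (p k ≤? hi A k)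

at-end⇒reaches-back : ∀ s {A p k} → p k ≡ end s A k → Reaches A p k (opposite s)
at-end⇒reaches-back plus  {A} {k = k} p≡hi = subst (lo A k <_) (sym p≡hi) (lo<hi A k) , ≤-reflexive p≡hi
at-end⇒reaches-back minus {A} {k = k} p≡lo = ≤-reflexive (sym p≡lo) , subst (_< hi A k) (sym p≡lo) (lo<hi A k)

at-end⇒¬reaches : ∀ s {A p k} → p k ≡ end s A k → ¬ Reaches A p k s
at-end⇒¬reaches plus  p≡hi (_ , p<hi) = <⇒≢ p<hi p≡hi
at-end⇒¬reaches minus p≡lo (lo<p , _) = <⇒≢ lo<p (sym p≡lo)

one-sided⇒at-end : ∀ s {A p k} → Reaches A p k s → ¬ Reaches A p k (opposite s) → p k ≡ end (opposite s) A k
one-sided⇒at-end plus  (lo≤p , p<hi) ¬below = ≤-antisym (≮⇒≥ λ lo<p → ¬below (lo<p , <⇒≤ p<hi)) lo≤p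
one-sided⇒at-end minus (lo<p , p≤hi) ¬above = ≤-antisym p≤hi (≮⇒≥ λ p<hi → ¬above (<⇒≤ lo<p , p<hi))

one-sided⇒vertex : ∀ s {A p k} → Reaches A p k s → ¬ Reaches A p k (opposite s) → p k ≡ lo A k ⊎ p k ≡ hi A k
one-sided⇒vertex plus  {A} {p} {k} reaches ¬reaches = inj₁ (one-sided⇒at-end plus {A} {p} {k} reaches ¬reaches)
one-sided⇒vertex minus {A} {p} {k} reaches ¬reaches = inj₂ (one-sided⇒at-end minus {A} {p} {k} reaches ¬reaches)

both-reach⇒overlap : ∀ s {A B p k} → Reaches A p k s → Reaches B p k s → lo A k < hi B k × lo B k < hi A k
both-reach⇒overlap plus  (loA≤p , p<hiA) (loB≤p , p<hiB) = ≤-<-trans loA≤p p<hiB , ≤-<-trans loB≤p p<hiA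
both-reach⇒overlap minus (loA<p , p≤hiA) (loB<p , p≤hiB) = <-≤-trans loA<p p≤hiB , <-≤-trans loB<p p≤hiA

reaches⇒off-hostFace : ∀ {n} (F : FloorPlan n) s {B p k} → Reaches (block F B) p k s → p k ≢ hostFace F s k
reaches⇒off-hostFace F plus  {B} {k = k} (_ , p<hi) = <⇒≢ (<-≤-trans p<hi (proj₂ (block-within-host F B k)))
reaches⇒off-hostFace F minus {B} {k = k} (lo<p , _) = ≢-sym (<⇒≢ (≤-<-trans (proj₁ (block-within-host F B k)) lo<p))

-- Next to p, every axis-parallel line crosses no block face or host face between p and the
-- nearby point, so a block occupies an octant at p iff it contains that octant's sample point.
module Near {n : ℕ} (F : FloorPlan n) (p : Point) where

  critical : Axis → List ℚ
  critical k = 0ℚ ∷ hostHi F k ∷ map (λ B → lo (block F B) k) (allFin n) ++ map (λ B → hi (block F B) k) (allFin n)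

  private
    above : ∀ k → ∃ λ w → p k < w × All (λ v → ¬ p k < v ⊎ w < v) (critical k)
    above k = gap-above <-isStrictTotalOrder <-dense (p<p+1 (p k)) (critical k)

    below : ∀ k → ∃ λ w → w < p k × All (λ v → ¬ v < p k ⊎ v < w) (critical k)
    below k = gap-above (Flip.isStrictTotalOrder <-isStrictTotalOrder)
                        (λ r<q → let m , r<m , m<q = <-dense r<q in m , m<q , r<m) (p-1<p (p k)) (critical k)

  nearby : Axis → Sign → ℚ
  nearby k plus  = proj₁ (above k)
  nearby k minus = proj₁ (below k)

  private
    clear-above : ∀ {k v} → v ∈ critical k → ¬ p k < v ⊎ nearby k plus < v
    clear-above = All.lookup (proj₂ (proj₂ (above _)))

    clear-below : ∀ {k v} → v ∈ critical k → ¬ v < p k ⊎ v < nearby k minus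
    clear-below = All.lookup (proj₂ (proj₂ (below _)))

    lo∈critical : ∀ B k → lo (block F B) k ∈ critical k
    lo∈critical B k = there (there (∈-++⁺ˡ (∈-map⁺ (λ B → lo (block F B) k) (∈-allFin B))))

    hi∈critical : ∀ B k → hi (block F B) k ∈ critical k
    hi∈critical B k = there (there (∈-++⁺ʳ (map (λ B → lo (block F B) k) (allFin n))
                                           (∈-map⁺ (λ B → hi (block F B) k) (∈-allFin B))))

  reaches⇒nearby-inside : ∀ s {B k} → Reaches (block F B) p k s →
                          lo (block F B) k < nearby k s × nearby k s < hi (block F B) k
  reaches⇒nearby-inside plus {B} {k} (lo≤p , p<hi) =
    ≤-<-trans lo≤p (proj₁ (proj₂ (above k))) , [ contradiction p<hi , id ]′ (clear-above (hi∈critical B k))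
  reaches⇒nearby-inside minus {B} {k} (lo<p , p≤hi) =
    [ contradiction lo<p , id ]′ (clear-below (lo∈critical B k)) , <-≤-trans (proj₁ (proj₂ (below k))) p≤hi

  nearby-inside⇒reaches : ∀ s {B k} → lo (block F B) k ≤ nearby k s → nearby k s ≤ hi (block F B) k →
                          Reaches (block F B) p k s
  nearby-inside⇒reaches plus {B} {k} lo≤w w≤hi =
    [ ≮⇒≥ , (λ w<lo → contradiction (<-≤-trans w<lo lo≤w) (<-irrefl refl)) ]′ (clear-above (lo∈critical B k)) ,
    <-≤-trans (proj₁ (proj₂ (above k))) w≤hi
  nearby-inside⇒reaches minus {B} {k} lo≤w w≤hi =
    ≤-<-trans lo≤w (proj₁ (proj₂ (below k))) ,
    [ ≮⇒≥ , (λ hi<w → contradiction (<-≤-trans hi<w w≤hi) (<-irrefl refl)) ]′ (clear-below (hi∈critical B k))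

  nearby-in-host : ∀ s {k} → 0ℚ ≤ p k → p k ≤ hostHi F k → p k ≢ hostFace F s k →
                   0ℚ ≤ nearby k s × nearby k s ≤ hostHi F k
  nearby-in-host plus {k} 0≤p p≤host p≢host =
    ≤-trans 0≤p (<⇒≤ (proj₁ (proj₂ (above k)))) ,
    [ contradiction (≤∧≢⇒< p≤host p≢host) , <⇒≤ ]′ (clear-above (there (here refl)))
  nearby-in-host minus {k} 0≤p p≤host p≢0 =
    [ contradiction (≤∧≢⇒< 0≤p (≢-sym p≢0)) , <⇒≤ ]′ (clear-below (here refl)) ,
    ≤-trans (<⇒≤ (proj₁ (proj₂ (below k)))) p≤host

  Occupies : Fin n → Octant → Set
  Occupies B o = ∀ k → Reaches (block F B) p k (o k)

  sample : Octant → Point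
  sample o k = nearby k (o k)

  occupant-unique : ∀ {o B B′} → Occupies B o → Occupies B′ o → B ≡ B′
  occupant-unique {o} {B} {B′} occ occ′ with B Fin.≟ B′
  ... | yes B≡B′ = B≡B′
  ... | no B≢B′  = ⊥-elim (disjoint F B B′ (sample o) B≢B′ (λ k → reaches⇒nearby-inside (o k) (occ k))
                                                            (λ k → reaches⇒nearby-inside (o k) (occ′ k)))

  occupant-exists : ∀ o → (∀ k → 0ℚ ≤ sample o k × sample o k ≤ hostHi F k) → ∃ λ B → Occupies B o
  occupant-exists o in-host with cover F (sample o) in-host
  ... | B , sample∈B = B , λ k → nearby-inside⇒reaches (o k) (proj₁ (sample∈B k)) (proj₂ (sample∈B k))

HasParent : ∀ {n} → FloorPlan n → HostCorner → Fin n → Set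
HasParent F σ A = ∃₂ λ B ℓ → ParentEdge F σ A B ℓ

module _ {n : ℕ} (F : FloorPlan n) (σ : HostCorner) (A : Fin n) where

  private
    p : Point
    p = closestVertex (block F A) σ

    open Near F p

    In Out : Axis → Fin n → Set
    In  k B = Reaches (block F B) p k (opposite (σ k))
    Out k B = Reaches (block F B) p k (σ k)

    Free : Axis → Set
    Free k = p k ≢ cornerPt F σ k

    p≡end : ∀ k → p k ≡ end (σ k) (block F A) k
    p≡end = closestVertex≡end (block F A) σ

    p∈A : p ∈B block F A
    p∈A = isVertex⇒∈B (block F A) (closestVertex-isVertex (block F A) σ)

    A-in : ∀ k → In k A
    A-in k = at-end⇒reaches-back (σ k) (p≡end k)

    A-out : ∀ k → ¬ Out k A
    A-out k = at-end⇒¬reaches (σ k) (p≡end k)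

    Out⇒Free : ∀ {k B} → Out k B → Free k
    Out⇒Free {k} out at-corner = reaches⇒off-hostFace F (σ k) out (trans at-corner (cornerPt≡hostFace F σ k))

    direction : (Axis → Bool) → Octant
    direction c k = if c k then σ k else opposite (σ k)

    side⇒reaches : ∀ b {k B} → Side In Out b k B → Reaches (block F B) p k (if b then σ k else opposite (σ k))
    side⇒reaches true  r = r
    side⇒reaches false r = r

    reaches⇒side : ∀ b {k B} → Reaches (block F B) p k (if b then σ k else opposite (σ k)) → Side In Out b k B
    reaches⇒side true  r = r
    reaches⇒side false r = r

    fills-unique : ∀ {c B B′} → Fills In Out c B → Fills In Out c B′ → B ≡ B′
    fills-unique {c} fills fills′ =
      occupant-unique (λ k → side⇒reaches (c k) (fills k)) (λ k → side⇒reaches (c k) (fills′ k))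

    off-face : ∀ c → (∀ k → c k ≡ true → Free k) → ∀ k → p k ≢ hostFace F (direction c k) k
    off-face c free k with c k in ck
    ... | true  = λ on-face → free k ck (trans on-face (sym (cornerPt≡hostFace F σ k)))
    ... | false = λ on-face → end≢opposite-hostFace F (σ k) A k (trans (sym (p≡end k)) on-face)

    fills-exists : ∀ c → (∀ k → c k ≡ true → Free k) → ∃ (Fills In Out c)
    fills-exists c free with occupant-exists (direction c) in-host
      where
      in-host : ∀ k → 0ℚ ≤ sample (direction c) k × sample (direction c) k ≤ hostHi F k
      in-host k = let 0≤p , p≤host = inside F A p p∈A k in
                  nearby-in-host (direction c k) 0≤p p≤host (off-face c free k)
    ... | B , occupies = B , λ k → reaches⇒side (c k) (occupies k)

    open Neighbours {In = In} {Out = Out} (λ k B → reaches? (block F B) p k (σ k)) Out⇒Free A-in A-out (λ {c} → fills-unique {c}) fills-exists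

    face-parent : ∀ {i B} → ¬ (p ≗ᵖ cornerPt F σ) → FaceNeighbour i B → ParentEdge F σ A B (axisLabel i)
    face-parent {i} {B} off (out-i , ¬in-i , sideways) =
      off , A≢B , vertex , faceTouch⇒axisEdge i {p = p} (touch , overlapping)
      where
      A≢B : A ≢ B
      A≢B refl = A-out i out-i
      vertex : IsVertex p (block F B)
      vertex k with k ≟ₐ i
      ... | yes refl = one-sided⇒vertex (σ k) out-i ¬in-i
      ... | no k≢i   = one-sided⇒vertex (opposite (σ k)) (proj₁ (sideways k k≢i))
                         (subst (λ s → ¬ Reaches (block F B) p k s) (sym (opposite-involutive (σ k)))
                                (proj₂ (sideways k k≢i)))
      touch : hi (block F A) i ≡ lo (block F B) i ⊎ hi (block F B) i ≡ lo (block F A) i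
      touch = opposite-ends⇒touch (σ i) (trans (sym (p≡end i)) (one-sided⇒at-end (σ i) out-i ¬in-i))
      overlapping : ∀ j → j ≢ i → lo (block F A) j < hi (block F B) j × lo (block F B) j < hi (block F A) j
      overlapping j j≢i = both-reach⇒overlap (opposite (σ j)) (A-in j) (proj₁ (sideways j j≢i))

    diagonal-parent : ∀ {B} → ¬ (p ≗ᵖ cornerPt F σ) → DiagonalNeighbour B → ParentEdge F σ A B d
    diagonal-parent {B} off opposite-octant = off , A≢B , vertex , meet
      where
      A≢B : A ≢ B
      A≢B refl = A-out X (proj₁ (opposite-octant X))
      vertex : IsVertex p (block F B)
      vertex k = one-sided⇒vertex (σ k) (proj₁ (opposite-octant k)) (proj₂ (opposite-octant k))
      squeeze : ∀ {q} → q ∈B block F A → q ∈B block F B → q ≗ᵖ p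
      squeeze q∈A q∈B k =
        trans (opposite-ends⇒squeeze (σ k)
                (trans (sym (p≡end k)) (one-sided⇒at-end (σ k) (proj₁ (opposite-octant k)) (proj₂ (opposite-octant k))))
                q∈A q∈B)
              (sym (p≡end k))
      meet : EdgeType (block F A) (block F B) p d
      meet q = mk⇔ (λ (q∈A , q∈B) → squeeze q∈A q∈B)
                   (λ q≗p → ∈B-resp-≗ᵖ (block F A) q≗p p∈A , ∈B-resp-≗ᵖ (block F B) q≗p (isVertex⇒∈B (block F B) vertex))

  parent-exists : ∀ i → closestVertex (block F A) σ i ≢ cornerPt F σ i → HasParent F σ A
  parent-exists i off-i with neighbour-exists i off-i
  ... | inj₁ (j , B , face) = B , axisLabel j , face-parent (λ at-corner → off-i (at-corner i)) face
  ... | inj₂ (B , diagonal) = B , d , diagonal-parent (λ at-corner → off-i (at-corner i)) diagonal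

module _ {n : ℕ} (F : FloorPlan n) (σ : HostCorner) (A : Fin n) where

  private
    on-face⇒end : ∀ s k → lo (block F A) k ≤ hostFace F s k → hostFace F s k ≤ hi (block F A) k →
                  end s (block F A) k ≡ hostFace F s k
    on-face⇒end plus  k _ host≤hi = ≤-antisym (proj₂ (block-within-host F A k)) host≤hi
    on-face⇒end minus k lo≤0 _    = ≤-antisym lo≤0 (proj₁ (block-within-host F A k))

  root⇒at-corner : IsRoot F σ A → closestVertex (block F A) σ ≗ᵖ cornerPt F σ
  root⇒at-corner root k = begin
    closestVertex (block F A) σ k   ≡⟨ closestVertex≡end (block F A) σ k ⟩
    end (σ k) (block F A) k         ≡⟨ on-face⇒end (σ k) k (proj₁ corner∈A) (proj₂ corner∈A) ⟩
    hostFace F (σ k) k              ≡⟨ cornerPt≡hostFace F σ k ⟨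
    cornerPt F σ k                  ∎
    where
    open ≡-Reasoning
    corner∈A : lo (block F A) k ≤ hostFace F (σ k) k × hostFace F (σ k) k ≤ hi (block F A) k
    corner∈A = subst (λ v → lo (block F A) k ≤ v × v ≤ hi (block F A) k) (cornerPt≡hostFace F σ k) (root k)

  root⇔parentless : IsRoot F σ A ⇔ (¬ HasParent F σ A)
  root⇔parentless = mk⇔ (λ root (_ , _ , off-corner , _) → off-corner (root⇒at-corner root)) parentless⇒root
    where
    parentless⇒root : ¬ HasParent F σ A → IsRoot F σ A
    parentless⇒root parentless with differs-or-agrees (closestVertex (block F A) σ) (cornerPt F σ)
    ... | inj₁ (i , off-i) = ⊥-elim (parentless (parent-exists F σ A i off-i))
    ... | inj₂ at-corner  = ∈B-resp-≗ᵖ (block F A) (λ k → sym (at-corner k))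
                              (isVertex⇒∈B (block F A) (closestVertex-isVertex (block F A) σ))

ParentEdges⊆ : ∀ {n} → FloorPlan n → FloorPlan n → HostCorner → Set
ParentEdges⊆ F F′ τ = ∀ A B ℓ → ParentEdge F τ A B ℓ → ParentEdge F′ τ A B ℓ

parentEdges⊆-from-neighbours : ∀ {n} {F F′ : FloorPlan n} σ →
                               (∀ i → ParentEdges⊆ F F′ (flipAt i σ)) → ParentEdges⊆ F F′ (antipode σ) →
                               ParentEdges⊆ F F′ σ
parentEdges⊆-from-neighbours {F = F} {F′} σ faces diagonal A B = through
  where
  through-face : ∀ i → ParentEdge F σ A B (axisLabel i) → ParentEdge F′ σ A B (axisLabel i)
  through-face i =
    reverse-face-edge F′ {flipAt i σ} {σ} {B} {A} i (adjacent-sym (flipAt-adjacent i σ))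
    ∘ faces i B A (axisLabel i)
    ∘ reverse-face-edge F {σ} {flipAt i σ} {A} {B} i (flipAt-adjacent i σ)
  through : ∀ ℓ → ParentEdge F σ A B ℓ → ParentEdge F′ σ A B ℓ
  through x = through-face X
  through y = through-face Y
  through z = through-face Z
  through d =
    reverse-diagonal-edge F′ {antipode σ} {σ} {B} {A} (antipodal-sym (antipode-antipodal σ))
    ∘ diagonal B A d
    ∘ reverse-diagonal-edge F {σ} {antipode σ} {A} {B} (antipode-antipodal σ)

root-from-parentEdges : ∀ {n} (F F′ : FloorPlan n) σ → ParentEdges⊆ F′ F σ → ∀ A → IsRoot F σ A → IsRoot F′ σ A
root-from-parentEdges F F′ σ edges⊆ A root =
  from (root⇔parentless F′ σ A) λ (B , ℓ , parent) → to (root⇔parentless F σ A) root (B , ℓ , edges⊆ A B ℓ parent)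

sameTree-from-neighbours : ∀ {n} {F F′ : FloorPlan n} σ →
  SameTree F F′ (flipAt X σ) → SameTree F F′ (flipAt Y σ) → SameTree F F′ (flipAt Z σ) →
  SameTree F F′ (antipode σ) → SameTree F F′ σ
sameTree-from-neighbours {F = F} {F′} σ tX tY tZ tD =
  (λ A → mk⇔ (root-from-parentEdges F F′ σ backward A) (root-from-parentEdges F′ F σ forward A)) ,
  (λ A B ℓ → mk⇔ (forward A B ℓ) (backward A B ℓ))
  where
  face : ∀ i → SameTree F F′ (flipAt i σ)
  face X = tX
  face Y = tY
  face Z = tZ
  forward : ParentEdges⊆ F F′ σ
  forward = parentEdges⊆-from-neighbours σ (λ i A B ℓ → to (proj₂ (face i) A B ℓ)) (λ A B ℓ → to (proj₂ tD A B ℓ))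
  backward : ParentEdges⊆ F′ F σ
  backward = parentEdges⊆-from-neighbours σ (λ i A B ℓ → from (proj₂ (face i) A B ℓ)) (λ A B ℓ → from (proj₂ tD A B ℓ))

proposition2 : (n : ℕ) (F F' : FloorPlan n) → Generic F → Generic F' →
    SameTree F F' c1 → SameTree F F' c3 → SameTree F F' c6 → SameTree F F' c8 →
    SameTree F F' c2 × SameTree F F' c4 × SameTree F F' c5 × SameTree F F' c7
proposition2 n F F' _ _ t1 t3 t6 t8 =
  sameTree-from-neighbours c2 t1 t3 t6 t8 ,
  sameTree-from-neighbours c4 t3 t1 t8 t6 ,
  sameTree-from-neighbours c5 t6 t8 t1 t3 ,
  sameTree-from-neighbours c7 t8 t6 t3 t1
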